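{- Let $\mathcal{B}$ be a connected building set on a finite set $E$ and $T$ a maximal $\mathcal{B}$-tree. Define $p(T)\in\mathbb{R}^E$ by letting $p(T)_s$ be the number of paths $\pi$ in $T$ whose topmost vertex is $s$. Then for every $s\in E$, $$\sum_{r\in D(s,T)}p(T)_r=\binom{|D(s,T)|+1}{2}.$$
   Context: A building set on $E$ is a collection $\mathcal{B}$ of non-empty subsets of $E$ closed under union of intersecting members and containing all singletons; it is connected if $E\in\mathcal{B}$. For a vertex $v$ of a rooted tree $T$ whose vertices are labeled by subsets of $E$, the descendant set $D(v,T)$ is the union of the labels of all descendants of $v$, including $v$ itself. A $\mathcal{B}$-tree is a rooted tree whose vertex labels partition $E$ such that (1) $D(v,T)\in\mathcal{B}$ for every vertex $v$, and (2) for any $k\ge2$ pairwise incomparable vertices $v_1,\dots,v_k$, the union $\bigcup_i D(v_i,T)$ is not in $\mathcal{B}$. It is maximal if all labels are singletons; its vertices are then identified with the elements of $E$. A path in $T$ is the set of vertices of the unique path in the (undirected) tree between two vertices $a,b$ (unordered, with $a=b$ allowed, giving the trivial path $\{a\}$); its topmost vertex is its vertex closest to the root. -}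

module Defs where

open import Data.Nat using (ℕ; zero; suc; _≤ᵇ_; _≤_)
open import Data.Bool using (Bool; true; false; _∧_; _∨_; not; if_then_else_; T)
open import Data.Fin using (Fin; toℕ; _≟_)
open import Data.Fin.Subset using (Subset; _∈_; _∩_; _∪_; ⁅_⁆; ⊤; Nonempty; ∣_∣)
open import Data.Maybe using (Maybe; just; nothing)
open import Data.List using (List; []; _∷_; length; map; allFin)
open import Data.Bool.ListAction using (any; all)
open import Data.Nat.ListAction using (sum)
open import Data.Vec using (tabulate; lookup)
open import Data.Product using (Σ; _×_)
open import Relation.Nullary using (¬_; ⌊_⌋)
open import Relation.Binary.PropositionalEquality using (_≡_; _≢_)

record IsBuildingSet {n : ℕ} (B : Subset n → Set) : Set₁ where
  field
    members-nonempty : ∀ X → B X → Nonempty X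
    union-closed     : ∀ X Y → B X → B Y → Nonempty (X ∩ Y) → B (X ∪ Y)
    singletons       : ∀ i → B ⁅ i ⁆

IsConnected : {n : ℕ} → (Subset n → Set) → Set
IsConnected B = B ⊤

-- A rooted tree on vertex set Fin n, given by a parent map (nothing = root).
Parent : ℕ → Set
Parent n = Fin n → Maybe (Fin n)

ancList : {n : ℕ} → ℕ → Parent n → Fin n → List (Fin n)
ancList zero    p v = v ∷ []
ancList (suc k) p v with p v
... | nothing = v ∷ []
... | just w  = v ∷ ancList k p w

-- anc p u v : u is an ancestor of v (or u = v), i.e. v is a descendant of u
anc : {n : ℕ} → Parent n → Fin n → Fin n → Bool
anc {n} p u v = any (λ x → ⌊ x ≟ u ⌋) (ancList n p v)

depth : {n : ℕ} → Parent n → Fin n → ℕ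
depth {n} p v = length (ancList n p v)

IsRootedTree : {n : ℕ} → Parent n → Set
IsRootedTree {n} p =
  Σ (Fin n) λ root → (p root ≡ nothing)
    × (∀ v → T (anc p root v))
    × (∀ v → p v ≡ nothing → v ≡ root)

-- descendant set D(v,T) (labels are singletons, so vertices = elements of E)
D : {n : ℕ} → Parent n → Fin n → Subset n
D p v = tabulate (λ x → anc p v x)

unionD : {n : ℕ} → Parent n → Subset n → Subset n
unionD {n} p S = tabulate (λ x → any (λ v → lookup S v ∧ anc p v x) (allFin n))

IsMaximalBTree : {n : ℕ} → (Subset n → Set) → Parent n → Set
IsMaximalBTree {n} B p =
  IsRootedTree p
  × (∀ v → B (D p v))
  × (∀ (S : Subset n) → 2 ≤ ∣ S ∣
       → (∀ u v → u ∈ S → v ∈ S → u ≢ v → ¬ T (anc p u v))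
       → ¬ B (unionD p S))

onPath : {n : ℕ} → Parent n → Fin n → Fin n → Fin n → Bool
onPath {n} p a b x =
  (anc p x a ∨ anc p x b)
  ∧ all (λ c → not (anc p c a ∧ anc p c b) ∨ anc p c x) (allFin n)

topmost : {n : ℕ} → Parent n → Fin n → Fin n → Fin n → Bool
topmost {n} p a b s =
  onPath p a b s ∧ all (λ x → not (onPath p a b x) ∨ (depth p s ≤ᵇ depth p x)) (allFin n)

-- p(T)_s : number of paths (unordered endpoint pairs {a,b}, a = b allowed) with topmost vertex s
pT : {n : ℕ} → Parent n → Fin n → ℕ
pT {n} p s =
  sum (map (λ a → sum (map (λ b →
     if (toℕ a ≤ᵇ toℕ b) ∧ topmost p a b s then 1 else 0) (allFin n))) (allFin n))

sumOverD : {n : ℕ} → Parent n → Fin n → ℕ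
sumOverD {n} p s = sum (map (λ r → if lookup (D p s) r then pT p r else 0) (allFin n))

-- Grouping the paths by their topmost vertex, ∑_{r ∈ D(s)} p(T)_r counts the paths whose
-- topmost vertex lies in D(s).  The topmost vertex of the path between a and b is their
-- lowest common ancestor, which lies in D(s) exactly when a and b both do; so the sum counts
-- the pairs a ≤ b of elements of D(s), of which there are C(|D(s)| + 1, 2).

module Submission where

open import Defs
open import Data.Nat using (ℕ; suc)
open import Data.Nat.Combinatorics using (_C_)
open import Data.Fin using (Fin)
open import Data.Fin.Subset using (Subset; ∣_∣)
open import Relation.Binary.PropositionalEquality using (_≡_)

open import Data.Nat.Properties
  using (+-0-commutativeMonoid; +-identityʳ; ≤-refl; m≤n⇒m≤1+n; ≤⇒≤ᵇ; ≤ᵇ⇒≤; <⇒≱)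
open import Algebra.Properties.CommutativeMonoid.Sum +-0-commutativeMonoid
  using (sum-syntax; ∑-comm; sum-cong-≗; sum-replicate-zero; sum-remove)
open import Data.Bool.Base using (Bool; true; false; _∧_; _∨_; not; if_then_else_; T)
open import Data.Bool.Properties using (T-∧; T-∨; T-≡; T?; ∧-comm; ∧-identityʳ; if-∧)
open import Data.Bool.ListAction using (any; all)
open import Data.Empty using (⊥-elim)
open import Data.Fin.Base using (zero; suc; toℕ; punchIn)
open import Data.Fin.Properties using (_≟_; punchInᵢ≢i)
import Data.List.Base as List using (map; tabulate; length)
open import Data.List.Base using (List; _∷_; allFin)
open import Data.List.Membership.Propositional using (_∈_)
open import Data.List.Membership.Propositional.Properties using (∈-allFin)
open import Data.List.Properties using (map-tabulate)
open import Data.List.Relation.Unary.Any using (here; there)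
import Data.List.Relation.Unary.Any as Any
open import Data.List.Relation.Unary.Any.Properties using (any⁺; any⁻)
import Data.List.Relation.Unary.All as All
open import Data.List.Relation.Unary.All.Properties using (all⁺; all⁻)
open import Data.Maybe.Base using (just; nothing)
import Data.Nat.Base as ℕ
open import Data.Nat.Base using (_+_; _≤ᵇ_; _≤_; _<_; s≤s)
open import Data.Nat.ListAction using (sum)
open import Data.Nat.Combinatorics using (nC1≡n; nCk+nC[k+1]≡[n+1]C[k+1])
open import Data.Product.Base using (_,_; proj₁; proj₂)
open import Data.Sum.Base using (_⊎_; inj₁; inj₂)
open import Data.Unit.Base using (tt)
open import Data.Vec.Base using (_∷_; tabulate; lookup)
open import Data.Vec.Properties using (lookup∘tabulate)
open import Function.Base using (_∘_; id; case_of_)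
open import Function.Bundles using (_⇔_; mk⇔; Equivalence)
open import Relation.Binary.PropositionalEquality
  using (_≢_; refl; sym; trans; cong; cong₂; subst; module ≡-Reasoning)
open import Relation.Nullary using (Dec; yes; no; ⌊_⌋)
open import Relation.Nullary.Decidable using (map′; toWitness; fromWitness)

open Equivalence using (to; from)
open ≡-Reasoning

T-injective : ∀ {b c} → T b ⇔ T c → b ≡ c
T-injective {false} {false} _   = refl
T-injective {false} {true}  b⇔c = ⊥-elim (b⇔c .from tt)
T-injective {true}  {false} b⇔c = ⊥-elim (b⇔c .to tt)
T-injective {true}  {true}  _   = refl

T-not-∨ : ∀ {b c} → T (not b ∨ c) ⇔ (T b → T c)
T-not-∨ {false} = mk⇔ (λ _ ()) (λ _ → tt)
T-not-∨ {true}  = mk⇔ (λ c _ → c) (λ f → f tt)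

T-any-≟ : ∀ {n} {u : Fin n} {xs : List (Fin n)} → T (any (λ x → ⌊ x ≟ u ⌋) xs) ⇔ u ∈ xs
T-any-≟ {u = u} = mk⇔
  (Any.map (λ {x} t → sym (toWitness {a? = x ≟ u} t)) ∘ any⁻ _ _)
  (any⁺ _ ∘ Any.map (λ u≡x → fromWitness (sym u≡x)))

T-all-implication : ∀ {n} (P Q : Fin n → Bool) →
                    T (all (λ x → not (P x) ∨ Q x) (allFin n)) ⇔ (∀ x → T (P x) → T (Q x))
T-all-implication P Q = mk⇔
  (λ h x → T-not-∨ .to (All.lookup (all⁺ _ _ h) (∈-allFin x)))
  (λ h → all⁻ _ (All.universal (λ x → T-not-∨ .from (h x)) (allFin _)))

sum-tabulate : ∀ {n} (f : Fin n → ℕ) → sum (List.tabulate f) ≡ ∑[ i < n ] f i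
sum-tabulate {ℕ.zero}  f = refl
sum-tabulate {ℕ.suc n} f = cong (f zero +_) (sum-tabulate (f ∘ suc))

sum-map-allFin : ∀ {n} (f : Fin n → ℕ) → sum (List.map f (allFin n)) ≡ ∑[ i < n ] f i
sum-map-allFin f = trans (cong sum (map-tabulate id f)) (sum-tabulate f)

∑-if : ∀ {n} b (f : Fin n → ℕ) → (if b then ∑[ i < n ] f i else 0) ≡ ∑[ i < n ] (if b then f i else 0)
∑-if         true  f = refl
∑-if {n = n} false f = sym (sum-replicate-zero n)

∑-concentrated : ∀ {n} (f : Fin n → ℕ) (c : Fin n) → (∀ i → i ≢ c → f i ≡ 0) → ∑[ i < n ] f i ≡ f c
∑-concentrated {ℕ.suc n} f c f≡0 = begin
  ∑[ i < suc n ] f i                 ≡⟨ sum-remove f ⟩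
  f c + ∑[ j < n ] f (punchIn c j)   ≡⟨ cong (f c +_) (sum-cong-≗ (λ j → f≡0 _ (punchInᵢ≢i c j))) ⟩
  f c + ∑[ j < n ] 0                 ≡⟨ cong (f c +_) (sum-replicate-zero n) ⟩
  f c + 0                            ≡⟨ +-identityʳ (f c) ⟩
  f c                                ∎

∑-indicator-supported-at : ∀ {n} (P : Fin n → Bool) (c : Fin n) → (∀ i → T (P i) → i ≡ c) →
                           ∑[ i < n ] (if P i then 1 else 0) ≡ (if P c then 1 else 0)
∑-indicator-supported-at P c only-c = ∑-concentrated _ c vanishes
  where
  vanishes : ∀ i → i ≢ c → (if P i then 1 else 0) ≡ 0
  vanishes i i≢c with P i | only-c i
  ... | true  | i≡c = ⊥-elim (i≢c (i≡c tt))
  ... | false | _   = refl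

∣tabulate∣≡∑ : ∀ {n} (f : Fin n → Bool) → ∣ tabulate f ∣ ≡ ∑[ i < n ] (if f i then 1 else 0)
∣tabulate∣≡∑ {ℕ.zero}  f = refl
∣tabulate∣≡∑ {ℕ.suc n} f with f zero
... | true  = cong suc (∣tabulate∣≡∑ (f ∘ suc))
... | false = ∣tabulate∣≡∑ (f ∘ suc)

1+m≤ᵇ1+n : ∀ m n → (suc m ≤ᵇ suc n) ≡ (m ≤ᵇ n)
1+m≤ᵇ1+n ℕ.zero    n = refl
1+m≤ᵇ1+n (ℕ.suc m) n = refl

1+k+[1+k]C2≡[2+k]C2 : ∀ k → suc k + suc k C 2 ≡ suc (suc k) C 2
1+k+[1+k]C2≡[2+k]C2 k =
  trans (cong (_+ suc k C 2) (sym (nC1≡n (suc k)))) (nCk+nC[k+1]≡[n+1]C[k+1] (suc k) 1)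

∑-pairs≤-within : ∀ {n} (f : Fin n → Bool) →
  ∑[ a < n ] ∑[ b < n ] (if (toℕ a ≤ᵇ toℕ b) ∧ (f a ∧ f b) then 1 else 0) ≡ suc ∣ tabulate f ∣ C 2
∑-pairs≤-within {ℕ.zero}  f = refl
∑-pairs≤-within {ℕ.suc n} f = begin
  ∑[ b < suc n ] (if f zero ∧ f b then 1 else 0)
    + ∑[ a < n ] ∑[ b < n ] (if (toℕ (suc a) ≤ᵇ toℕ (suc b)) ∧ (f (suc a) ∧ f (suc b)) then 1 else 0)
      ≡⟨ cong₂ _+_ pairs-from-zero
                   (sum-cong-≗ λ a → sum-cong-≗ λ b →
                     cong (λ le → if le ∧ (f (suc a) ∧ f (suc b)) then 1 else 0) (1+m≤ᵇ1+n (toℕ a) (toℕ b))) ⟩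
  (if f zero then ∣ tabulate f ∣ else 0)
    + ∑[ a < n ] ∑[ b < n ] (if (toℕ a ≤ᵇ toℕ b) ∧ (f (suc a) ∧ f (suc b)) then 1 else 0)
      ≡⟨ cong ((if f zero then ∣ tabulate f ∣ else 0) +_) (∑-pairs≤-within (f ∘ suc)) ⟩
  (if f zero then ∣ tabulate f ∣ else 0) + suc ∣ tabulate (f ∘ suc) ∣ C 2
      ≡⟨ cons-step (f zero) (tabulate (f ∘ suc)) ⟩
  suc ∣ tabulate f ∣ C 2
      ∎
  where
  pairs-from-zero : ∑[ b < suc n ] (if f zero ∧ f b then 1 else 0) ≡ (if f zero then ∣ tabulate f ∣ else 0)
  pairs-from-zero = begin
    ∑[ b < suc n ] (if f zero ∧ f b then 1 else 0)
      ≡⟨ sum-cong-≗ (λ b → if-∧ (f zero) {f b} {1} {0}) ⟩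
    ∑[ b < suc n ] (if f zero then (if f b then 1 else 0) else 0)
      ≡⟨ ∑-if (f zero) (λ b → if f b then 1 else 0) ⟨
    (if f zero then ∑[ b < suc n ] (if f b then 1 else 0) else 0)
      ≡⟨ cong (if f zero then_else 0) (∣tabulate∣≡∑ f) ⟨
    (if f zero then ∣ tabulate f ∣ else 0)
      ∎
  cons-step : ∀ x (S : Subset n) → (if x then ∣ x ∷ S ∣ else 0) + suc ∣ S ∣ C 2 ≡ suc ∣ x ∷ S ∣ C 2
  cons-step true  S = 1+k+[1+k]C2≡[2+k]C2 ∣ S ∣
  cons-step false S = refl

pT≡∑∑ : ∀ {n} (p : Parent n) r →
        pT p r ≡ ∑[ a < n ] ∑[ b < n ] (if (toℕ a ≤ᵇ toℕ b) ∧ topmost p a b r then 1 else 0)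
pT≡∑∑ {n} p r = begin
  pT p r
    ≡⟨ sum-map-allFin (λ a → sum (List.map (topped a) (allFin n))) ⟩
  ∑[ a < n ] sum (List.map (topped a) (allFin n))
    ≡⟨ sum-cong-≗ (λ a → sum-map-allFin (topped a)) ⟩
  ∑[ a < n ] ∑[ b < n ] topped a b
    ∎
  where
  topped : Fin n → Fin n → ℕ
  topped a b = if (toℕ a ≤ᵇ toℕ b) ∧ topmost p a b r then 1 else 0

sumOverD≡∑ : ∀ {n} (p : Parent n) s → sumOverD p s ≡ ∑[ r < n ] (if anc p s r then pT p r else 0)
sumOverD≡∑ p s = trans (sum-map-allFin (λ r → if lookup (D p s) r then pT p r else 0))
                       (sum-cong-≗ λ r → cong (if_then pT p r else 0) (lookup∘tabulate (anc p s) r))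

module Ancestry {n : ℕ} (p : Parent n) where

  infix 4 _≼_

  -- Unlike the Boolean anc, which follows parents for at most n steps, this relation
  -- needs no fuel; anc⇔≼ shows that the two agree in a rooted tree.

  data _≼_ : Fin n → Fin n → Set where
    ≼-refl   : ∀ {v} → v ≼ v
    ≼-parent : ∀ {u v w} → p v ≡ just w → u ≼ w → u ≼ v

  ≼-trans : ∀ {u v x} → u ≼ v → v ≼ x → u ≼ x
  ≼-trans u≼v ≼-refl             = u≼v
  ≼-trans u≼v (≼-parent e v≼w)   = ≼-parent e (≼-trans u≼v v≼w)

  ≼-parent⁻ : ∀ {u v w} → p v ≡ just w → u ≼ v → u ≡ v ⊎ u ≼ w
  ≼-parent⁻ _ ≼-refl = inj₁ refl
  ≼-parent⁻ e (≼-parent e′ u≼w′) with trans (sym e) e′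
  ... | refl = inj₂ u≼w′

  ∈-ancList⇒≼ : ∀ k {u v} → u ∈ ancList k p v → u ≼ v
  ∈-ancList⇒≼ ℕ.zero    (here refl) = ≼-refl
  ∈-ancList⇒≼ (ℕ.suc k) {v = v} u∈ with p v in e
  ∈-ancList⇒≼ (ℕ.suc k) (here refl) | nothing = ≼-refl
  ∈-ancList⇒≼ (ℕ.suc k) (here refl) | just w  = ≼-refl
  ∈-ancList⇒≼ (ℕ.suc k) (there u∈) | just w  = ≼-parent e (∈-ancList⇒≼ k u∈)

  ancList-unfold : ∀ k {v w} → p v ≡ just w → ancList (suc k) p v ≡ v ∷ ancList k p w
  ancList-unfold k e rewrite e = refl

module RootedTree {n : ℕ} (p : Parent n) (root : Fin n) (root-parentless : p root ≡ nothing)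
                  (root-anc : ∀ v → T (anc p root v)) where

  open Ancestry p

  root≢parented : ∀ {v w} → p v ≡ just w → root ≢ v
  root≢parented e refl with trans (sym e) root-parentless
  ... | ()

  ancList-stable : ∀ k {v} → root ∈ ancList k p v → ancList (suc k) p v ≡ ancList k p v
  ancList-stable ℕ.zero    (here refl) rewrite root-parentless = refl
  ancList-stable (ℕ.suc k) {v} root∈ with p v in e
  ... | nothing = refl
  ... | just w with root∈
  ...   | here root≡v  = ⊥-elim (root≢parented e root≡v)
  ...   | there root∈′ = cong (v ∷_) (ancList-stable k root∈′)

  ancList-parent : ∀ k {v w} → root ∈ ancList k p v → p v ≡ just w → ancList k p v ≡ v ∷ ancList k p w
  ancList-parent ℕ.zero    (here root≡v) e = ⊥-elim (root≢parented e root≡v)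
  ancList-parent (ℕ.suc k) {v} {w} root∈ e = begin
    ancList (suc k) p v      ≡⟨ ancList-unfold k e ⟩
    v ∷ ancList k p w        ≡⟨ cong (v ∷_) (ancList-stable k root∈w) ⟨
    v ∷ ancList (suc k) p w  ∎
    where
    root∈w : root ∈ ancList k p w
    root∈w with subst (root ∈_) (ancList-unfold k e) root∈
    ... | here root≡v = ⊥-elim (root≢parented e root≡v)
    ... | there r     = r

  ∈-ancList-self : ∀ k v → v ∈ ancList k p v
  ∈-ancList-self ℕ.zero    v = here refl
  ∈-ancList-self (ℕ.suc k) v with p v
  ... | nothing = here refl
  ... | just _  = here refl

  root∈ancList : ∀ v → root ∈ ancList n p v
  root∈ancList v = T-any-≟ .to (root-anc v)

  ≼⇒∈-ancList : ∀ {u v} → u ≼ v → u ∈ ancList n p v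
  ≼⇒∈-ancList {v = v} ≼-refl = ∈-ancList-self n v
  ≼⇒∈-ancList {u} {v} (≼-parent e u≼w) =
    subst (u ∈_) (sym (ancList-parent n (root∈ancList v) e)) (there (≼⇒∈-ancList u≼w))

  anc⇔≼ : ∀ {u v} → T (anc p u v) ⇔ u ≼ v
  anc⇔≼ = mk⇔ (∈-ancList⇒≼ n ∘ T-any-≟ .to) (T-any-≟ .from ∘ ≼⇒∈-ancList)

  root-≼ : ∀ v → root ≼ v
  root-≼ v = anc⇔≼ .to (root-anc v)

  _≼?_ : ∀ u v → Dec (u ≼ v)
  u ≼? v = map′ (anc⇔≼ .to) (anc⇔≼ .from) (T? (anc p u v))

  depth-parent : ∀ {v w} → p v ≡ just w → depth p v ≡ suc (depth p w)
  depth-parent {v} e = cong List.length (ancList-parent n (root∈ancList v) e)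

  ≼⇒depth≤ : ∀ {u v} → u ≼ v → depth p u ≤ depth p v
  ≼⇒depth≤ ≼-refl           = ≤-refl
  ≼⇒depth≤ (≼-parent e u≼w) = subst (_ ≤_) (sym (depth-parent e)) (m≤n⇒m≤1+n (≼⇒depth≤ u≼w))

  ≼⇒depth< : ∀ {u v} → u ≼ v → u ≢ v → depth p u < depth p v
  ≼⇒depth< ≼-refl           u≢v = ⊥-elim (u≢v refl)
  ≼⇒depth< (≼-parent e u≼w) _   = subst (_ <_) (sym (depth-parent e)) (s≤s (≼⇒depth≤ u≼w))

  record LowestCommonAncestor (a b : Fin n) : Set where
    field
      lca   : Fin n
      lca≼a : lca ≼ a
      lca≼b : lca ≼ b
      ≼-lca : ∀ {c} → c ≼ a → c ≼ b → c ≼ lca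

  -- Climb from a towards the root until reaching an ancestor of b; recursion on root ≼ a.
  lowestCommonAncestor : ∀ {a} → root ≼ a → ∀ b → LowestCommonAncestor a b
  lowestCommonAncestor {a} r b with a ≼? b
  ... | yes a≼b = record { lca = a ; lca≼a = ≼-refl ; lca≼b = a≼b ; ≼-lca = λ c≼a _ → c≼a }
  lowestCommonAncestor ≼-refl           b | no root⋠b = ⊥-elim (root⋠b (root-≼ b))
  lowestCommonAncestor (≼-parent e r≼w) b | no a⋠b = record
    { lca   = lca
    ; lca≼a = ≼-trans lca≼a (≼-parent e ≼-refl)
    ; lca≼b = lca≼b
    ; ≼-lca = λ c≼a c≼b → case ≼-parent⁻ e c≼a of λ where
        (inj₁ refl) → ⊥-elim (a⋠b c≼b)
        (inj₂ c≼w)  → ≼-lca c≼w c≼b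
    }
    where open LowestCommonAncestor (lowestCommonAncestor r≼w b)

  module Path (a b : Fin n) where

    open LowestCommonAncestor (lowestCommonAncestor (root-≼ a) b) public

    onPath⇒lca≼ : ∀ {x} → T (onPath p a b x) → lca ≼ x
    onPath⇒lca≼ {x} on =
      anc⇔≼ .to (T-all-implication (λ c → anc p c a ∧ anc p c b) (λ c → anc p c x) .to
                   (proj₂ (T-∧ .to on)) lca (T-∧ .from (anc⇔≼ .from lca≼a , anc⇔≼ .from lca≼b)))

    onPath-lca : T (onPath p a b lca)
    onPath-lca = T-∧ .from (T-∨ .from (inj₁ (anc⇔≼ .from lca≼a)) ,
      T-all-implication (λ c → anc p c a ∧ anc p c b) (λ c → anc p c lca) .from λ c c≼a∧b →
        let c≼a , c≼b = T-∧ .to c≼a∧b in anc⇔≼ .from (≼-lca (anc⇔≼ .to c≼a) (anc⇔≼ .to c≼b)))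

    topmost-lca : T (topmost p a b lca)
    topmost-lca = T-∧ .from (onPath-lca ,
      T-all-implication (onPath p a b) (λ x → depth p lca ≤ᵇ depth p x) .from λ x on →
        ≤⇒≤ᵇ (≼⇒depth≤ (onPath⇒lca≼ on)))

    topmost⇒≡lca : ∀ {x} → T (topmost p a b x) → x ≡ lca
    topmost⇒≡lca {x} top with x ≟ lca
    ... | yes x≡lca = x≡lca
    ... | no  x≢lca = ⊥-elim (<⇒≱ (≼⇒depth< (onPath⇒lca≼ on) (x≢lca ∘ sym)) depth-x≤lca)
      where
      on = proj₁ (T-∧ .to top)
      depth-x≤lca : depth p x ≤ depth p lca
      depth-x≤lca = ≤ᵇ⇒≤ _ _ (T-all-implication (onPath p a b) (λ y → depth p x ≤ᵇ depth p y) .to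
                               (proj₂ (T-∧ .to top)) lca onPath-lca)

    anc-lca : ∀ s → anc p s lca ≡ anc p s a ∧ anc p s b
    anc-lca s = T-injective (mk⇔
      (λ s≼lca → T-∧ .from (anc⇔≼ .from (≼-trans (anc⇔≼ .to s≼lca) lca≼a) ,
                            anc⇔≼ .from (≼-trans (anc⇔≼ .to s≼lca) lca≼b)))
      (λ s≼a∧b → let s≼a , s≼b = T-∧ .to s≼a∧b in
                 anc⇔≼ .from (≼-lca (anc⇔≼ .to s≼a) (anc⇔≼ .to s≼b))))

  paths-topped-within : ∀ s a b →
    ∑[ r < n ] (if anc p s r ∧ ((toℕ a ≤ᵇ toℕ b) ∧ topmost p a b r) then 1 else 0)
      ≡ (if (toℕ a ≤ᵇ toℕ b) ∧ (anc p s a ∧ anc p s b) then 1 else 0)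
  paths-topped-within s a b =
    trans (∑-indicator-supported-at _ lca λ r h →
             topmost⇒≡lca (proj₂ (T-∧ {a≤b} .to (proj₂ (T-∧ {anc p s r} .to h)))))
          (cong (if_then 1 else 0) topped-at-lca)
    where
    open Path a b
    a≤b = toℕ a ≤ᵇ toℕ b
    topped-at-lca : anc p s lca ∧ (a≤b ∧ topmost p a b lca) ≡ a≤b ∧ (anc p s a ∧ anc p s b)
    topped-at-lca = begin
      anc p s lca ∧ (a≤b ∧ topmost p a b lca)
        ≡⟨ cong₂ (λ x y → x ∧ (a≤b ∧ y)) (anc-lca s) (T-≡ .to topmost-lca) ⟩
      (anc p s a ∧ anc p s b) ∧ (a≤b ∧ true)
        ≡⟨ cong ((anc p s a ∧ anc p s b) ∧_) (∧-identityʳ a≤b) ⟩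
      (anc p s a ∧ anc p s b) ∧ a≤b
        ≡⟨ ∧-comm _ a≤b ⟩
      a≤b ∧ (anc p s a ∧ anc p s b)
        ∎

  sumOverD≡[1+∣D∣]C2 : ∀ s → sumOverD p s ≡ suc ∣ D p s ∣ C 2
  sumOverD≡[1+∣D∣]C2 s = begin
    sumOverD p s
      ≡⟨ sumOverD≡∑ p s ⟩
    ∑[ r < n ] (if anc p s r then pT p r else 0)
      ≡⟨ sum-cong-≗ indicator-inside ⟩
    ∑[ r < n ] ∑[ a < n ] ∑[ b < n ] χ r a b
      ≡⟨ ∑-comm (λ r a → ∑[ b < n ] χ r a b) ⟩
    ∑[ a < n ] ∑[ r < n ] ∑[ b < n ] χ r a b
      ≡⟨ sum-cong-≗ (λ a → ∑-comm (λ r b → χ r a b)) ⟩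
    ∑[ a < n ] ∑[ b < n ] ∑[ r < n ] χ r a b
      ≡⟨ sum-cong-≗ (λ a → sum-cong-≗ (paths-topped-within s a)) ⟩
    ∑[ a < n ] ∑[ b < n ] (if (toℕ a ≤ᵇ toℕ b) ∧ (anc p s a ∧ anc p s b) then 1 else 0)
      ≡⟨ ∑-pairs≤-within (anc p s) ⟩
    suc ∣ D p s ∣ C 2
      ∎
    where
    topped : Fin n → Fin n → Fin n → ℕ
    topped r a b = if (toℕ a ≤ᵇ toℕ b) ∧ topmost p a b r then 1 else 0
    χ : Fin n → Fin n → Fin n → ℕ
    χ r a b = if anc p s r ∧ ((toℕ a ≤ᵇ toℕ b) ∧ topmost p a b r) then 1 else 0
    indicator-inside : ∀ r → (if anc p s r then pT p r else 0) ≡ ∑[ a < n ] ∑[ b < n ] χ r a b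
    indicator-inside r = begin
      (if anc p s r then pT p r else 0)
        ≡⟨ cong (if anc p s r then_else 0) (pT≡∑∑ p r) ⟩
      (if anc p s r then ∑[ a < n ] ∑[ b < n ] topped r a b else 0)
        ≡⟨ ∑-if (anc p s r) (λ a → ∑[ b < n ] topped r a b) ⟩
      ∑[ a < n ] (if anc p s r then ∑[ b < n ] topped r a b else 0)
        ≡⟨ sum-cong-≗ (λ a → ∑-if (anc p s r) (topped r a)) ⟩
      ∑[ a < n ] ∑[ b < n ] (if anc p s r then topped r a b else 0)
        ≡⟨ sum-cong-≗ (λ a → sum-cong-≗ λ b →
             if-∧ (anc p s r) {(toℕ a ≤ᵇ toℕ b) ∧ topmost p a b r} {1} {0}) ⟨
      ∑[ a < n ] ∑[ b < n ] χ r a b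
        ∎

lemma3p2 : (n : ℕ) (B : Subset n → Set) → IsBuildingSet B → IsConnected B
    → (p : Parent n) → IsMaximalBTree B p
    → (s : Fin n) → sumOverD p s ≡ (suc ∣ D p s ∣) C 2
lemma3p2 _ _ _ _ p ((root , root-parentless , root-anc , _) , _) =
  RootedTree.sumOverD≡[1+∣D∣]C2 p root root-parentless root-anc
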